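{- Let $k\ge1$, let $m_1,\dots,m_N$ ($N=M(k)$) be all monotonic Boolean functions $\mathbb{B}^k\to\mathbb{B}$, and write $\mathbf{m}(\mathbf{x})=(m_1(\mathbf{x}),\dots,m_N(\mathbf{x}))\in\mathbb{B}^N$. For a coefficient vector $c=(c_0,a_i,b_l,\alpha_{ij},\beta_{il},\gamma_{ll'})$ let $$H_c(\mathbf{x},\mathbf{z})=c_0+\sum_{i=1}^k a_ix_i+\sum_{l=1}^N b_lz_l+\sum_{1\le i<j\le k}\alpha_{ij}x_ix_j+\sum_{i,l}\beta_{il}x_iz_l+\sum_{1\le l<l'\le N}\gamma_{ll'}z_lz_{l'},\qquad \mathbf{x}\in\mathbb{B}^k,\ \mathbf{z}\in\mathbb{B}^N.$$ Given $f:\mathbb{B}^k\to\mathbb{R}$, consider the linear program in the variables $c$ and $(t_{\mathbf{x}})_{\mathbf{x}\in\mathbb{B}^k}$: minimize $\sum_{\mathbf{x}}t_{\mathbf{x}}$ subject to (i) $t_{\mathbf{x}}\ge f(\mathbf{x})-H_c(\mathbf{x},\mathbf{m}(\mathbf{x}))$ and $t_{\mathbf{x}}\ge H_c(\mathbf{x},\mathbf{m}(\mathbf{x}))-f(\mathbf{x})$ for all $\mathbf{x}$; (ii) $\alpha_{ij}\le0$, $\beta_{il}\le0$, $\gamma_{ll'}\le0$ for all indices; (iii) $H_c(\mathbf{x},\mathbf{m}(\mathbf{x}))\le H_c(\mathbf{x},\mathbf{z})$ for all $\mathbf{x}\in\mathbb{B}^k$ and all $\mathbf{z}\in\mathbb{B}^N$.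 If $f\in\mathcal{F}^k_2$, then this linear program is feasible with optimal value $0$, and for every optimal solution the function $H_c$ lies in $\mathcal{F}^2$ and satisfies $f(\mathbf{x})=\min_{\mathbf{z}\in\mathbb{B}^N}H_c(\mathbf{x},\mathbf{z})$ for all $\mathbf{x}\in\mathbb{B}^k$.
   Context: $\mathbb{B}=\{0,1\}$. Pseudo-Boolean functions $\mathbb{B}^n\to\mathbb{R}$ are uniquely multilinear polynomials; order = degree. Submodular: $f(X)+f(Y)\ge f(X\vee Y)+f(X\wedge Y)$. $\mathcal{F}^2$: submodular pseudo-Boolean functions of order $\le2$ (degree-$\le2$ multilinear polynomials with non-positive bilinear coefficients). $\mathcal{F}^k_2$: the set of submodular $f:\mathbb{B}^k\to\mathbb{R}$ for which there exist $m$ and $h\in\mathcal{F}^2$ on $\mathbb{B}^k\times\mathbb{B}^m$ with $f(\mathbf{x})=\min_{\mathbf{z}}h(\mathbf{x},\mathbf{z})$ for all $\mathbf{x}$. A monotonic Boolean function is $\phi:\mathbb{B}^k\to\mathbb{B}$ with $\phi(\mathbf{y})\le\phi(\mathbf{x})$ whenever $\mathbf{y}\le\mathbf{x}$ componentwise; $M(k)$ (Dedekind number) is their number. The paper expresses constraint (iii) (that $\mathbf{m}(\mathbf{x})$ is a minimizing labeling of the auxiliary variables) through a max-flow linear program; here it is written as the equivalent finite family of linear inequalities. -}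

module Defs where

open import Level using (0ℓ)
open import Data.Bool using (Bool; true; false; _∧_; _∨_; if_then_else_)
import Data.Bool as B
open import Data.Nat using (ℕ; zero; suc) renaming (_+_ to _+ℕ_)
open import Data.Fin using (Fin; _<?_) renaming (_<_ to _<ᶠ_)
import Data.Fin as Fin
open import Data.Vec using (Vec; []; _∷_; lookup; zipWith; take; drop)
open import Data.Product using (Σ; ∃; _×_; _,_)
open import Relation.Nullary using (¬_)
open import Relation.Nullary.Decidable using (⌊_⌋)
open import Relation.Binary using (Rel; IsTotalOrder)
open import Relation.Binary.PropositionalEquality using (_≡_; _≢_)
open import Algebra.Structures using (IsCommutativeRing)

-- Agda's standard library has no real numbers; the
-- statement only uses the ordered-field structure of ℝ, so we state it
-- for an arbitrary (discrete) ordered field, of which ℝ is an instance.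

record OrderedField : Set₁ where
  infixl 7 _*_
  infixl 6 _+_
  infix  4 _≤_
  field
    Carrier : Set
    _+_ _*_ : Carrier → Carrier → Carrier
    -_      : Carrier → Carrier
    0# 1#   : Carrier
    _≤_     : Rel Carrier 0ℓ
    isCommutativeRing : IsCommutativeRing _≡_ _+_ _*_ -_ 0# 1#
    isTotalOrder      : IsTotalOrder _≡_ _≤_
    0≢1     : 0# ≢ 1#
    inverse : ∀ x → x ≢ 0# → ∃ λ y → x * y ≡ 1#
    +-mono-≤ : ∀ {x y} z → x ≤ y → x + z ≤ y + z
    *-nonneg : ∀ {x y} → 0# ≤ x → 0# ≤ y → 0# ≤ x * y

module _ (F : OrderedField) where
  open OrderedField F

  _-_ : Carrier → Carrier → Carrier
  x - y = x + (- y)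

  ⟦_⟧ : Bool → Carrier
  ⟦ true ⟧  = 1#
  ⟦ false ⟧ = 0#

  Σ[_] : (n : ℕ) → (Fin n → Carrier) → Carrier
  Σ[ zero ]  g = 0#
  Σ[ suc n ] g = g Fin.zero + Σ[ n ] (λ i → g (Fin.suc i))

  Σ<[_] : (n : ℕ) → (Fin n → Fin n → Carrier) → Carrier
  Σ<[ n ] g = Σ[ n ] (λ i → Σ[ n ] (λ j → if ⌊ i <? j ⌋ then g i j else 0#))

  Σ𝔹[_] : (n : ℕ) → (Vec Bool n → Carrier) → Carrier
  Σ𝔹[ zero ]  g = g []
  Σ𝔹[ suc n ] g = Σ𝔹[ n ] (λ x → g (false ∷ x)) + Σ𝔹[ n ] (λ x → g (true ∷ x))

  PBF : ℕ → Set
  PBF n = Vec Bool n → Carrier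

  Submodular : ∀ {n} → PBF n → Set
  Submodular f = ∀ X Y → f (zipWith _∨_ X Y) + f (zipWith _∧_ X Y) ≤ f X + f Y

  OrderLe2 : ∀ {n} → PBF n → Set
  OrderLe2 {n} f = Σ Carrier λ d₀ → Σ (Fin n → Carrier) λ d → Σ (Fin n → Fin n → Carrier) λ e →
    ∀ x → f x ≡ d₀ + Σ[ n ] (λ i → d i * ⟦ lookup x i ⟧)
                   + Σ<[ n ] (λ i j → e i j * (⟦ lookup x i ⟧ * ⟦ lookup x j ⟧))

  InF2 : ∀ {n} → PBF n → Set
  InF2 f = Submodular f × OrderLe2 f

  uncurry𝔹 : ∀ {k m} → (Vec Bool k → Vec Bool m → Carrier) → PBF (k +ℕ m)
  uncurry𝔹 {k} {m} h v = h (take k v) (drop k v)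

  IsMinOver : ∀ {m} → Carrier → (Vec Bool m → Carrier) → Set
  IsMinOver v g = (∃ λ z → g z ≡ v) × (∀ z → v ≤ g z)

  InFk2 : ∀ {k} → PBF k → Set
  InFk2 {k} f = Submodular f × Σ ℕ λ m → Σ (Vec Bool k → Vec Bool m → Carrier) λ h →
    InF2 (uncurry𝔹 h) × (∀ x → IsMinOver (f x) (h x))

  _≤𝔹_ : ∀ {k} → Vec Bool k → Vec Bool k → Set
  y ≤𝔹 x = ∀ i → lookup y i B.≤ lookup x i

  Monotonic : ∀ {k} → (Vec Bool k → Bool) → Set
  Monotonic φ = ∀ x y → y ≤𝔹 x → φ y B.≤ φ x

  EnumeratesMonotone : ∀ {k} N → (Fin N → Vec Bool k → Bool) → Set
  EnumeratesMonotone {k} N m =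
      (∀ l → Monotonic (m l))
    × (∀ (φ : Vec Bool k → Bool) → Monotonic φ → ∃ λ l → ∀ x → m l x ≡ φ x)
    × (∀ l l′ → (∀ x → m l x ≡ m l′ x) → l ≡ l′)

  record Coeffs (k N : ℕ) : Set where
    field
      c₀ : Carrier
      a  : Fin k → Carrier
      b  : Fin N → Carrier
      α  : Fin k → Fin k → Carrier   -- only entries i < j are used
      β  : Fin k → Fin N → Carrier
      γ  : Fin N → Fin N → Carrier   -- only entries l < l′ are used

  H : ∀ {k N} → Coeffs k N → Vec Bool k → Vec Bool N → Carrier
  H {k} {N} c x z =
      c₀
    + Σ[ k ] (λ i → a i * ⟦ lookup x i ⟧)
    + Σ[ N ] (λ l → b l * ⟦ lookup z l ⟧)
    + Σ<[ k ] (λ i j → α i j * (⟦ lookup x i ⟧ * ⟦ lookup x j ⟧))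
    + Σ[ k ] (λ i → Σ[ N ] (λ l → β i l * (⟦ lookup x i ⟧ * ⟦ lookup z l ⟧)))
    + Σ<[ N ] (λ l l′ → γ l l′ * (⟦ lookup z l ⟧ * ⟦ lookup z l′ ⟧))
    where open Coeffs c

  mvec : ∀ {k N} → (Fin N → Vec Bool k → Bool) → Vec Bool k → Vec Bool N
  mvec {N = N} m x = Data.Vec.tabulate (λ l → m l x)

  module LP {k N : ℕ} (m : Fin N → Vec Bool k → Bool) (f : PBF k) where

    objective : (Vec Bool k → Carrier) → Carrier
    objective t = Σ𝔹[ k ] t

    Feasible : Coeffs k N → (Vec Bool k → Carrier) → Set
    Feasible c t =
        (∀ x → (f x - H c x (mvec m x) ≤ t x) × (H c x (mvec m x) - f x ≤ t x))
      × (∀ (i j : Fin k) → i <ᶠ j → Coeffs.α c i j ≤ 0#)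
      × (∀ i l → Coeffs.β c i l ≤ 0#)
      × (∀ (l l′ : Fin N) → l <ᶠ l′ → Coeffs.γ c l l′ ≤ 0#)
      × (∀ x z → H c x (mvec m x) ≤ H c x z)

    Optimal : Coeffs k N → (Vec Bool k → Carrier) → Set
    Optimal c t = Feasible c t × (∀ c′ t′ → Feasible c′ t′ → objective t ≤ objective t′)

-- Write f x = min_w h x w with h ∈ 𝓕². By submodularity of h, minimizers of h x and of h y with
-- x ≤ y meet in a minimizer of h x, so meeting chosen minimizers over all y ≥ x yields a minimizer
-- s x that is monotone in x. Each coordinate of s is then one of the m_l, say m_{π j}, and
-- substituting z_{π j} for the j-th auxiliary variable of h gives some H_c with
-- H_c(x, 𝐦(x)) = f x ≤ H_c(x, z). The substitution pushes the quadratic form of h forward along π,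
-- so the pair coefficients of H_c stay non-positive (those of h are, again by submodularity).
-- Hence t = 0 is feasible, and optimal since t x ≥ |f x − H_c(x, 𝐦(x))| ≥ 0. Conversely an optimal
-- solution has objective 0, so t = 0 and H_c(x, 𝐦(x)) = f x, which is the minimum over z by (iii);
-- and (ii) makes H_c submodular.

module Submission where

open import Defs
open import Data.Bool using (Bool; true; false; _∧_; _∨_; not; if_then_else_)
import Data.Bool as B
import Data.Bool.Properties as BP
open import Data.Nat using (ℕ; zero; suc; _≥_) renaming (_+_ to _+ℕ_)
open import Data.Fin using (Fin; zero; suc; _≟_; _<?_; _↑ˡ_; _↑ʳ_; splitAt) renaming (_<_ to _<ᶠ_)
open import Data.Fin.Properties using (<-cmp; <-irrefl; <-asym)
open import Data.Fin.Subset using (Subset; _⊆_; _∩_; _∪_)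
open import Data.Fin.Subset.Properties
  using (⊆-refl; ⊆-trans; ⊆-antisym; _⊆?_; p∩q⊆p; p∩q⊆q; x∈p∩q⁺; x∈p∪q⁻; q⊆p∪q)
open import Data.Sum using (inj₁; inj₂; [_,_]′)
open import Data.Product using (Σ; _×_; _,_; proj₁; proj₂)
open import Data.Vec using (Vec; []; _∷_; lookup; zipWith; tabulate; _++_; take; drop)
open import Data.Vec.Properties
  using (lookup-++ˡ; lookup-++ʳ; lookup-splitAt; lookup-zipWith; lookup∘tabulate;
         tabulate-cong; tabulate∘lookup; zipWith-++; take++drop≡id; ++-injectiveˡ; ++-injectiveʳ;
         []=⇒lookup; lookup⇒[]=)
open import Function using (_∘_; id)
open import Relation.Binary using (IsTotalOrder; tri<; tri≈; tri>)
open import Relation.Binary.PropositionalEquality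
open ≡-Reasoning
open import Relation.Nullary using (Dec; yes; no; ¬_; contradiction)
open import Relation.Nullary.Decidable using (⌊_⌋; does; isYes≗does; dec-true; dec-false)
open import Algebra.Structures using (IsCommutativeRing)
open import Algebra.Bundles using (CommutativeRing)
import Algebra.Solver.Ring.NaturalCoefficients.Default as NatCoeffSolver
import Algebra.Properties.Semiring.Sum as SemiringSum

⌊⌋-true : ∀ {P : Set} (P? : Dec P) → P → ⌊ P? ⌋ ≡ true
⌊⌋-true P? p = trans (isYes≗does P?) (dec-true P? p)

⌊⌋-false : ∀ {P : Set} (P? : Dec P) → ¬ P → ⌊ P? ⌋ ≡ false
⌊⌋-false P? ¬p = trans (isYes≗does P?) (dec-false P? ¬p)

∧-not-disjoint : ∀ a c → a ∧ c ≡ false → a ∧ not c ≡ a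
∧-not-disjoint false c     _ = refl
∧-not-disjoint true  false _ = refl

not-∧-disjoint : ∀ a c → a ∧ c ≡ false → not a ∧ c ≡ c
not-∧-disjoint false c     _ = refl
not-∧-disjoint true  false _ = refl

p⊆q⇒p∩q≡p : ∀ {n} {p q : Subset n} → p ⊆ q → p ∩ q ≡ p
p⊆q⇒p∩q≡p p⊆q = ⊆-antisym (p∩q⊆p _ _) (λ x∈p → x∈p∩q⁺ (x∈p , p⊆q x∈p))

p⊆q⇒p∪q≡q : ∀ {n} {p q : Subset n} → p ⊆ q → p ∪ q ≡ q
p⊆q⇒p∪q≡q p⊆q = ⊆-antisym (λ x∈p∪q → [ p⊆q , id ]′ (x∈p∪q⁻ _ _ x∈p∪q)) (q⊆p∪q _ _)

-- Vectors in 𝔹ⁿ are handled as subsets of Fin n; the componentwise order _≤𝔹_ of Defs is then ⊆.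
⊆⇒lookup-≤ : ∀ {n} {p q : Subset n} → p ⊆ q → ∀ i → lookup p i B.≤ lookup q i
⊆⇒lookup-≤ {p = p} p⊆q i with lookup p i in eq
... | false = BP.≤-minimum _
... | true  = BP.≤-reflexive (sym ([]=⇒lookup (p⊆q (lookup⇒[]= i p eq))))

lookup-≤⇒⊆ : ∀ {n} {p q : Subset n} → (∀ i → lookup p i B.≤ lookup q i) → p ⊆ q
lookup-≤⇒⊆ {q = q} p≤q {i} i∈p =
  lookup⇒[]= i q (true≤⇒≡true (subst (B._≤ lookup q i) ([]=⇒lookup i∈p) (p≤q i)))
  where
  true≤⇒≡true : ∀ {b} → true B.≤ b → b ≡ true
  true≤⇒≡true B.b≤b = refl

⋂-cube : ∀ {k m} → (Subset k → Subset m) → Subset m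
⋂-cube {zero}  g = g []
⋂-cube {suc k} g = ⋂-cube (g ∘ (false ∷_)) ∩ ⋂-cube (g ∘ (true ∷_))

⋂-cube-lower : ∀ {k m} (g : Subset k → Subset m) y → ⋂-cube g ⊆ g y
⋂-cube-lower {zero}  g []          = ⊆-refl
⋂-cube-lower {suc k} g (false ∷ y) = ⊆-trans (p∩q⊆p _ _) (⋂-cube-lower (g ∘ (false ∷_)) y)
⋂-cube-lower {suc k} g (true ∷ y)  = ⊆-trans (p∩q⊆q _ _) (⋂-cube-lower (g ∘ (true ∷_)) y)

⋂-cube-greatest : ∀ {k m} {p : Subset m} (g : Subset k → Subset m) → (∀ y → p ⊆ g y) → p ⊆ ⋂-cube g
⋂-cube-greatest {zero}  g p⊆g = p⊆g []
⋂-cube-greatest {suc k} g p⊆g x∈p =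
  x∈p∩q⁺ ( ⋂-cube-greatest (g ∘ (false ∷_)) (p⊆g ∘ (false ∷_)) x∈p
         , ⋂-cube-greatest (g ∘ (true ∷_)) (p⊆g ∘ (true ∷_)) x∈p)

⋂-cube-closed : ∀ {k m} (P : Subset m → Set) → (∀ {p q} → P p → P q → P (p ∩ q)) →
                (g : Subset k → Subset m) → (∀ y → P (g y)) → P (⋂-cube g)
⋂-cube-closed {zero}  P closed g Pg = Pg []
⋂-cube-closed {suc k} P closed g Pg =
  closed (⋂-cube-closed P closed (g ∘ (false ∷_)) (Pg ∘ (false ∷_)))
         (⋂-cube-closed P closed (g ∘ (true ∷_)) (Pg ∘ (true ∷_)))

module _ (F : OrderedField) where
  open OrderedField F
  open IsCommutativeRing isCommutativeRing
    using (+-assoc; +-comm; +-identityˡ; +-identityʳ; -‿inverseʳ;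
           *-comm; *-identityˡ; distribˡ; distribʳ; zeroˡ)
  open IsTotalOrder isTotalOrder
    using () renaming (refl to ≤-refl; reflexive to ≤-reflexive; trans to ≤-trans;
                       antisym to ≤-antisym; total to ≤-total)

  private
    ring : CommutativeRing _ _
    ring = record { isCommutativeRing = isCommutativeRing }

  open NatCoeffSolver (CommutativeRing.commutativeSemiring ring) using (solve; _:+_; _:*_; _:=_)
  open SemiringSum (CommutativeRing.semiring ring) using (sum; sum-cong-≗; sum-replicate-zero; *-distribʳ-sum)
    renaming (∑-distrib-+ to sum-distrib-+; ∑-comm to sum-comm)

  𝟙 : Bool → Carrier
  𝟙 = ⟦_⟧ F

  ∑ : (n : ℕ) → (Fin n → Carrier) → Carrier
  ∑ = Σ[_] F

  +-monoʳ-≤ : ∀ z {x y} → x ≤ y → z + x ≤ z + y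
  +-monoʳ-≤ z {x} {y} x≤y = subst₂ _≤_ (+-comm x z) (+-comm y z) (+-mono-≤ z x≤y)

  +-cancelʳ-≤ : ∀ z {x y} → x + z ≤ y + z → x ≤ y
  +-cancelʳ-≤ z {x} {y} le = subst₂ _≤_ (cancel x) (cancel y) (+-mono-≤ (- z) le)
    where
    cancel : ∀ w → w + z + - z ≡ w
    cancel w = trans (+-assoc w z (- z)) (trans (cong (w +_) (-‿inverseʳ z)) (+-identityʳ w))

  +-cancelˡ-≤ : ∀ z {x y} → z + x ≤ z + y → x ≤ y
  +-cancelˡ-≤ z {x} {y} le = +-cancelʳ-≤ z (subst₂ _≤_ (+-comm z x) (+-comm z y) le)

  x≤x+y : ∀ {x y} → 0# ≤ y → x ≤ x + y
  x≤x+y {x} {y} 0≤y = subst (_≤ x + y) (+-identityʳ x) (+-monoʳ-≤ x 0≤y)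

  x+y≤x : ∀ {x y} → y ≤ 0# → x + y ≤ x
  x+y≤x {x} {y} y≤0 = subst (x + y ≤_) (+-identityʳ x) (+-monoʳ-≤ x y≤0)

  +-nonpos : ∀ {x y} → x ≤ 0# → y ≤ 0# → x + y ≤ 0#
  +-nonpos x≤0 y≤0 = ≤-trans (x+y≤x y≤0) x≤0

  +-nonneg : ∀ {x y} → 0# ≤ x → 0# ≤ y → 0# ≤ x + y
  +-nonneg 0≤x 0≤y = ≤-trans 0≤x (x≤x+y 0≤y)

  x-y≤0⇒x≤y : ∀ {x y} → x + - y ≤ 0# → x ≤ y
  x-y≤0⇒x≤y {x} {y} le = +-cancelʳ-≤ (- y) (subst (_ ≤_) (sym (-‿inverseʳ y)) le)

  distance-nonneg : ∀ {x y t} → x + - y ≤ t → y + - x ≤ t → 0# ≤ t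
  distance-nonneg {x} {y} {t} x-y≤t y-x≤t with ≤-total 0# t
  ... | inj₁ 0≤t = 0≤t
  ... | inj₂ t≤0 = subst (_≤ t) (-‿inverseʳ x) (subst (λ w → x + - w ≤ t) (sym x≡y) x-y≤t)
    where
    x≡y : x ≡ y
    x≡y = ≤-antisym (x-y≤0⇒x≤y (≤-trans x-y≤t t≤0)) (x-y≤0⇒x≤y (≤-trans y-x≤t t≤0))

  -- Finite sums

  ∑≡sum : ∀ n f → ∑ n f ≡ sum f
  ∑≡sum zero    f = refl
  ∑≡sum (suc n) f = cong (f zero +_) (∑≡sum n (f ∘ suc))

  ∑-cong : ∀ {n} {f g : Fin n → Carrier} → (∀ i → f i ≡ g i) → ∑ n f ≡ ∑ n g
  ∑-cong {zero}  f≗g = refl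
  ∑-cong {suc n} f≗g = cong₂ _+_ (f≗g zero) (∑-cong (f≗g ∘ suc))

  ∑-zero : ∀ n → ∑ n (λ _ → 0#) ≡ 0#
  ∑-zero n = trans (∑≡sum n _) (sum-replicate-zero n)

  ∑-distrib-+ : ∀ n (f g : Fin n → Carrier) → ∑ n (λ i → f i + g i) ≡ ∑ n f + ∑ n g
  ∑-distrib-+ n f g =
    trans (∑≡sum n _) (trans (sum-distrib-+ f g) (sym (cong₂ _+_ (∑≡sum n f) (∑≡sum n g))))

  ∑-*ʳ : ∀ n x (f : Fin n → Carrier) → ∑ n f * x ≡ ∑ n (λ i → f i * x)
  ∑-*ʳ n x f = trans (cong (_* x) (∑≡sum n f)) (trans (*-distribʳ-sum x f) (sym (∑≡sum n _)))

  ∑-*ˡ : ∀ n x (f : Fin n → Carrier) → x * ∑ n f ≡ ∑ n (λ i → x * f i)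
  ∑-*ˡ n x f = trans (*-comm x _) (trans (∑-*ʳ n x f) (∑-cong (λ i → *-comm (f i) x)))

  ∑-comm : ∀ m n (f : Fin m → Fin n → Carrier) →
           ∑ m (λ i → ∑ n (f i)) ≡ ∑ n (λ j → ∑ m (λ i → f i j))
  ∑-comm m n f = trans (∑²≡sum² m n f) (trans (sum-comm f) (sym (∑²≡sum² n m (λ j i → f i j))))
    where
    ∑²≡sum² : ∀ m n (g : Fin m → Fin n → Carrier) → ∑ m (λ i → ∑ n (g i)) ≡ sum (λ i → sum (g i))
    ∑²≡sum² m n g = trans (∑≡sum m _) (sum-cong-≗ (λ i → ∑≡sum n (g i)))

  ∑-nonpos : ∀ {n} {f : Fin n → Carrier} → (∀ i → f i ≤ 0#) → ∑ n f ≤ 0#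
  ∑-nonpos {zero}  f≤0 = ≤-refl
  ∑-nonpos {suc n} f≤0 = +-nonpos (f≤0 zero) (∑-nonpos (f≤0 ∘ suc))

  -- Stated with does rather than ⌊_⌋, which does not reduce on suc p ≟ suc q.
  ∑-δ : ∀ {n} (p : Fin n) (g : Fin n → Carrier) → ∑ n (λ q → 𝟙 (does (p ≟ q)) * g q) ≡ g p
  ∑-δ {suc n} zero g =
    trans (cong₂ _+_ (*-identityˡ (g zero)) (trans (∑-cong (λ q → zeroˡ (g (suc q)))) (∑-zero n)))
          (+-identityʳ (g zero))
  ∑-δ {suc n} (suc p) g = trans (cong₂ _+_ (zeroˡ (g zero)) (∑-δ p (g ∘ suc))) (+-identityˡ _)

  ∑-++ : ∀ k {N} (g : Fin (k +ℕ N) → Carrier) →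
         ∑ (k +ℕ N) g ≡ ∑ k (λ i → g (i ↑ˡ N)) + ∑ N (λ l → g (k ↑ʳ l))
  ∑-++ zero    g = sym (+-identityˡ _)
  ∑-++ (suc k) g = trans (cong (g zero +_) (∑-++ k (g ∘ suc))) (sym (+-assoc _ _ _))

  ∑²-cong : ∀ {m n} {f g : Fin m → Fin n → Carrier} → (∀ i j → f i j ≡ g i j) →
            ∑ m (λ i → ∑ n (f i)) ≡ ∑ m (λ i → ∑ n (g i))
  ∑²-cong f≗g = ∑-cong (λ i → ∑-cong (f≗g i))

  ∑²-distrib-+ : ∀ m n (f g : Fin m → Fin n → Carrier) →
                 ∑ m (λ i → ∑ n (λ j → f i j + g i j)) ≡ ∑ m (λ i → ∑ n (f i)) + ∑ m (λ i → ∑ n (g i))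
  ∑²-distrib-+ m n f g = trans (∑-cong (λ i → ∑-distrib-+ n (f i) (g i))) (∑-distrib-+ m _ _)

  push : ∀ {m n} → (Fin m → Fin n) → (Fin m → Carrier) → Fin n → Carrier
  push {m} ρ g p = ∑ m (λ i → 𝟙 (does (ρ i ≟ p)) * g i)

  push² : ∀ {m m′ n n′} → (Fin m → Fin n) → (Fin m′ → Fin n′) →
          (Fin m → Fin m′ → Carrier) → Fin n → Fin n′ → Carrier
  push² ρ σ E p q = push ρ (λ i → push σ (E i) q) p

  ∑-push : ∀ {m n} (ρ : Fin m → Fin n) (g : Fin m → Carrier) (w : Fin n → Carrier) →
           ∑ m (λ i → g i * w (ρ i)) ≡ ∑ n (λ p → push ρ g p * w p)
  ∑-push {m} {n} ρ g w = begin
      ∑ m (λ i → g i * w (ρ i))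
    ≡⟨ ∑-cong (λ i → cong (g i *_) (sym (∑-δ (ρ i) w))) ⟩
      ∑ m (λ i → g i * ∑ n (λ p → 𝟙 (does (ρ i ≟ p)) * w p))
    ≡⟨ ∑-cong (λ i → trans (∑-*ˡ n (g i) _) (∑-cong (λ p → rearrange (g i) _ (w p)))) ⟩
      ∑ m (λ i → ∑ n (λ p → 𝟙 (does (ρ i ≟ p)) * g i * w p))
    ≡⟨ ∑-comm m n _ ⟩
      ∑ n (λ p → ∑ m (λ i → 𝟙 (does (ρ i ≟ p)) * g i * w p))
    ≡⟨ ∑-cong (λ p → sym (∑-*ʳ m (w p) _)) ⟩
      ∑ n (λ p → push ρ g p * w p)
    ∎
    where
    rearrange : ∀ x y z → x * (y * z) ≡ y * x * z
    rearrange = solve 3 (λ x y z → x :* (y :* z) := y :* x :* z) refl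

  𝟙-∧ : ∀ a b → 𝟙 (a ∧ b) ≡ 𝟙 a * 𝟙 b
  𝟙-∧ true  b = sym (*-identityˡ (𝟙 b))
  𝟙-∧ false b = sym (zeroˡ (𝟙 b))

  𝟙-idem : ∀ a → 𝟙 a * 𝟙 a ≡ 𝟙 a
  𝟙-idem a = trans (sym (𝟙-∧ a a)) (cong 𝟙 (BP.∧-idem a))

  𝟙*-nonpos : ∀ b {x} → x ≤ 0# → 𝟙 b * x ≤ 0#
  𝟙*-nonpos true  {x} x≤0 = subst (_≤ 0#) (sym (*-identityˡ x)) x≤0
  𝟙*-nonpos false {x} _   = ≤-reflexive (zeroˡ x)

  *𝟙𝟙-nonpos : ∀ a b {x} → x ≤ 0# → x * (𝟙 a * 𝟙 b) ≤ 0#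
  *𝟙𝟙-nonpos a b {x} x≤0 =
    subst (_≤ 0#) (trans (*-comm _ x) (cong (x *_) (𝟙-∧ a b))) (𝟙*-nonpos (a ∧ b) x≤0)

  if-* : ∀ b x y → (if b then x else 0#) * y ≡ (if b then x * y else 0#)
  if-* true  x y = refl
  if-* false x y = zeroˡ y

  if≡𝟙* : ∀ b x → (if b then x else 0#) ≡ 𝟙 b * x
  if≡𝟙* true  x = sym (*-identityˡ x)
  if≡𝟙* false x = sym (zeroˡ x)

  𝟙-vennˡ : ∀ a c → 𝟙 a ≡ 𝟙 (a ∧ c) + 𝟙 (a ∧ not c)
  𝟙-vennˡ true  true  = sym (+-identityʳ 1#)
  𝟙-vennˡ true  false = sym (+-identityˡ 1#)
  𝟙-vennˡ false c     = sym (+-identityʳ 0#)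

  𝟙-vennʳ : ∀ a c → 𝟙 c ≡ 𝟙 (a ∧ c) + 𝟙 (not a ∧ c)
  𝟙-vennʳ true  c = sym (+-identityʳ (𝟙 c))
  𝟙-vennʳ false c = sym (+-identityˡ (𝟙 c))

  𝟙-venn∨ : ∀ a c → 𝟙 (a ∨ c) ≡ 𝟙 (a ∧ c) + 𝟙 (a ∧ not c) + 𝟙 (not a ∧ c)
  𝟙-venn∨ true  c = trans (𝟙-vennˡ true c) (sym (+-identityʳ _))
  𝟙-venn∨ false c = trans (𝟙-vennʳ false c) (cong (_+ 𝟙 c) (sym (+-identityʳ 0#)))

  𝟙-modular : ∀ a c → 𝟙 (a ∨ c) + 𝟙 (a ∧ c) ≡ 𝟙 a + 𝟙 c
  𝟙-modular a c = begin
      𝟙 (a ∨ c) + 𝟙 (a ∧ c)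
    ≡⟨ cong (_+ 𝟙 (a ∧ c)) (𝟙-venn∨ a c) ⟩
      𝟙 (a ∧ c) + 𝟙 (a ∧ not c) + 𝟙 (not a ∧ c) + 𝟙 (a ∧ c)
    ≡⟨ solve 3 (λ m s t → m :+ s :+ t :+ m := (m :+ s) :+ (m :+ t)) refl _ _ _ ⟩
      (𝟙 (a ∧ c) + 𝟙 (a ∧ not c)) + (𝟙 (a ∧ c) + 𝟙 (not a ∧ c))
    ≡⟨ sym (cong₂ _+_ (𝟙-vennˡ a c) (𝟙-vennʳ a c)) ⟩
      𝟙 a + 𝟙 c
    ∎

  -- With (a, c) the memberships of a position p in X and Y, and (b, d) those of q,
  -- this counts p ∈ X ∖ Y, q ∈ Y ∖ X and p ∈ Y ∖ X, q ∈ X ∖ Y.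
  crossing : Bool → Bool → Bool → Bool → Carrier
  crossing a b c d = 𝟙 (a ∧ not c) * 𝟙 (not b ∧ d) + 𝟙 (not a ∧ c) * 𝟙 (b ∧ not d)

  𝟙-modular² : ∀ a b c d → 𝟙 (a ∨ c) * 𝟙 (b ∨ d) + 𝟙 (a ∧ c) * 𝟙 (b ∧ d)
                          ≡ 𝟙 a * 𝟙 b + 𝟙 c * 𝟙 d + crossing a b c d
  𝟙-modular² a b c d = begin
      𝟙 (a ∨ c) * 𝟙 (b ∨ d) + 𝟙 (a ∧ c) * 𝟙 (b ∧ d)
    ≡⟨ cong₂ (λ u v → u * v + 𝟙 (a ∧ c) * 𝟙 (b ∧ d)) (𝟙-venn∨ a c) (𝟙-venn∨ b d) ⟩
      (m + s + t) * (m′ + s′ + t′) + m * m′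
    ≡⟨ solve 6 (λ m s t m′ s′ t′ → (m :+ s :+ t) :* (m′ :+ s′ :+ t′) :+ m :* m′
                 := (m :+ s) :* (m′ :+ s′) :+ (m :+ t) :* (m′ :+ t′) :+ (s :* t′ :+ t :* s′))
               refl m s t m′ s′ t′ ⟩
      (m + s) * (m′ + s′) + (m + t) * (m′ + t′) + crossing a b c d
    ≡⟨ sym (cong (_+ crossing a b c d) (cong₂ _+_ (cong₂ _*_ (𝟙-vennˡ a c) (𝟙-vennˡ b d))
                                                  (cong₂ _*_ (𝟙-vennʳ a c) (𝟙-vennʳ b d)))) ⟩
      𝟙 a * 𝟙 b + 𝟙 c * 𝟙 d + crossing a b c d
    ∎
    where
    m s t m′ s′ t′ : Carrier
    m = 𝟙 (a ∧ c); s = 𝟙 (a ∧ not c); t = 𝟙 (not a ∧ c)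
    m′ = 𝟙 (b ∧ d); s′ = 𝟙 (b ∧ not d); t′ = 𝟙 (not b ∧ d)

  *crossing-nonpos : ∀ a b c d {x} → x ≤ 0# → x * crossing a b c d ≤ 0#
  *crossing-nonpos a b c d {x} x≤0 =
    subst (_≤ 0#) (sym (distribˡ x _ _))
      (+-nonpos (*𝟙𝟙-nonpos (a ∧ not c) (not b ∧ d) x≤0) (*𝟙𝟙-nonpos (not a ∧ c) (b ∧ not d) x≤0))

  -- Linear and bilinear forms on indicator vectors

  linearForm : ∀ n → (Fin n → Carrier) → (Fin n → Bool) → Carrier
  linearForm n d u = ∑ n (λ i → d i * 𝟙 (u i))

  bilinearForm : ∀ m n → (Fin m → Fin n → Carrier) → (Fin m → Bool) → (Fin n → Bool) → Carrier
  bilinearForm m n E u v = ∑ m (λ i → ∑ n (λ j → E i j * (𝟙 (u i) * 𝟙 (v j))))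

  linearForm-cong : ∀ n d {u u′ : Fin n → Bool} → (∀ i → u i ≡ u′ i) → linearForm n d u ≡ linearForm n d u′
  linearForm-cong n d u≗u′ = ∑-cong (λ i → cong (λ b → d i * 𝟙 b) (u≗u′ i))

  bilinearForm-cong : ∀ m n E {u u′ : Fin m → Bool} {v v′ : Fin n → Bool} →
                      (∀ i → u i ≡ u′ i) → (∀ j → v j ≡ v′ j) →
                      bilinearForm m n E u v ≡ bilinearForm m n E u′ v′
  bilinearForm-cong m n E u≗u′ v≗v′ = ∑²-cong (λ i j → cong₂ (λ a b → E i j * (𝟙 a * 𝟙 b)) (u≗u′ i) (v≗v′ j))

  linearForm-+ : ∀ n d d′ u → linearForm n d u + linearForm n d′ u ≡ linearForm n (λ i → d i + d′ i) u
  linearForm-+ n d d′ u =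
    trans (sym (∑-distrib-+ n _ _)) (∑-cong (λ i → sym (distribʳ (𝟙 (u i)) (d i) (d′ i))))

  bilinearForm-+ : ∀ m n E E′ u v →
                   bilinearForm m n E u v + bilinearForm m n E′ u v
                     ≡ bilinearForm m n (λ i j → E i j + E′ i j) u v
  bilinearForm-+ m n E E′ u v =
    trans (sym (∑²-distrib-+ m n _ _)) (∑²-cong (λ i j → sym (distribʳ (𝟙 (u i) * 𝟙 (v j)) (E i j) (E′ i j))))

  bilinearForm-transpose : ∀ m n E u v → bilinearForm m n E u v ≡ bilinearForm n m (λ j i → E i j) v u
  bilinearForm-transpose m n E u v =
    trans (∑-comm m n _) (∑²-cong (λ j i → cong (E i j *_) (*-comm (𝟙 (u i)) (𝟙 (v j)))))

  linearForm-push : ∀ {m n} (ρ : Fin m → Fin n) d u → linearForm m d (u ∘ ρ) ≡ linearForm n (push ρ d) u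
  linearForm-push ρ d u = ∑-push ρ d (𝟙 ∘ u)

  bilinearForm-push : ∀ {m m′ n n′} (ρ : Fin m → Fin n) (σ : Fin m′ → Fin n′) E u v →
                      bilinearForm m m′ E (u ∘ ρ) (v ∘ σ) ≡ bilinearForm n n′ (push² ρ σ E) u v
  bilinearForm-push {m} {m′} {n} {n′} ρ σ E u v = begin
      ∑ m (λ i → ∑ m′ (λ j → E i j * W (ρ i) (σ j)))
    ≡⟨ ∑-cong (λ i → ∑-push σ (E i) (W (ρ i))) ⟩
      ∑ m (λ i → ∑ n′ (λ q → push σ (E i) q * W (ρ i) q))
    ≡⟨ ∑-comm m n′ _ ⟩
      ∑ n′ (λ q → ∑ m (λ i → push σ (E i) q * W (ρ i) q))
    ≡⟨ ∑-cong (λ q → ∑-push ρ (λ i → push σ (E i) q) (λ p → W p q)) ⟩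
      ∑ n′ (λ q → ∑ n (λ p → push² ρ σ E p q * W p q))
    ≡⟨ ∑-comm n′ n _ ⟩
      ∑ n (λ p → ∑ n′ (λ q → push² ρ σ E p q * W p q))
    ∎
    where
    W : Fin n → Fin n′ → Carrier
    W p q = 𝟙 (u p) * 𝟙 (v q)

  linearForm-++ : ∀ k {N} d (u : Fin (k +ℕ N) → Bool) {x : Fin k → Bool} {z : Fin N → Bool} →
    (∀ i → u (i ↑ˡ N) ≡ x i) → (∀ l → u (k ↑ʳ l) ≡ z l) →
    linearForm (k +ℕ N) d u ≡ linearForm k (d ∘ (_↑ˡ N)) x + linearForm N (d ∘ (k ↑ʳ_)) z
  linearForm-++ k {N} d u x≡ z≡ =
    trans (∑-++ k _) (cong₂ _+_ (linearForm-cong k _ x≡) (linearForm-cong N _ z≡))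

  bilinearForm-++ˡ : ∀ k {N n} E (u : Fin (k +ℕ N) → Bool) (v : Fin n → Bool) →
    bilinearForm (k +ℕ N) n E u v
      ≡ bilinearForm k n (E ∘ (_↑ˡ N)) (u ∘ (_↑ˡ N)) v + bilinearForm N n (E ∘ (k ↑ʳ_)) (u ∘ (k ↑ʳ_)) v
  bilinearForm-++ˡ k E u v = ∑-++ k _

  bilinearForm-++ʳ : ∀ {m} k {N} E (u : Fin m → Bool) (v : Fin (k +ℕ N) → Bool) →
    bilinearForm m (k +ℕ N) E u v
      ≡ bilinearForm m k (λ i j → E i (j ↑ˡ N)) u (v ∘ (_↑ˡ N))
        + bilinearForm m N (λ i l → E i (k ↑ʳ l)) u (v ∘ (k ↑ʳ_))
  bilinearForm-++ʳ {m} k {N} E u v =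
    trans (∑-cong (λ i → ∑-++ k {N} (λ j → E i j * (𝟙 (u i) * 𝟙 (v j))))) (∑-distrib-+ m _ _)

  bilinearForm-++ : ∀ k {N} E (u : Fin (k +ℕ N) → Bool) {x : Fin k → Bool} {z : Fin N → Bool} →
    (∀ i → u (i ↑ˡ N) ≡ x i) → (∀ l → u (k ↑ʳ l) ≡ z l) →
    bilinearForm (k +ℕ N) (k +ℕ N) E u u
      ≡ bilinearForm k k (λ i j → E (i ↑ˡ N) (j ↑ˡ N)) x x
        + bilinearForm k N (λ i l → E (i ↑ˡ N) (k ↑ʳ l) + E (k ↑ʳ l) (i ↑ˡ N)) x z
        + bilinearForm N N (λ l l′ → E (k ↑ʳ l) (k ↑ʳ l′)) z z
  bilinearForm-++ k {N} E u {x} {z} x≡ z≡ = begin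
      bilinearForm (k +ℕ N) (k +ℕ N) E u u
    ≡⟨ trans (bilinearForm-++ˡ k E u u) (cong₂ _+_ (bilinearForm-++ʳ k (E ∘ (_↑ˡ N)) (u ∘ (_↑ˡ N)) u)
                                                    (bilinearForm-++ʳ k (E ∘ (k ↑ʳ_)) (u ∘ (k ↑ʳ_)) u)) ⟩
      _
    ≡⟨ cong₂ _+_ (cong₂ _+_ (bilinearForm-cong k k Exx x≡ x≡) (bilinearForm-cong k N Exz x≡ z≡))
                 (cong₂ _+_ (bilinearForm-cong N k Ezx z≡ x≡) (bilinearForm-cong N N Ezz z≡ z≡)) ⟩
      (XX + XZ) + (ZX + ZZ)
    ≡⟨ solve 4 (λ a b c d → (a :+ b) :+ (c :+ d) := a :+ (b :+ c) :+ d) refl XX XZ ZX ZZ ⟩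
      XX + (XZ + ZX) + ZZ
    ≡⟨ cong (λ m → XX + m + ZZ)
            (trans (cong (XZ +_) (bilinearForm-transpose N k Ezx z x)) (bilinearForm-+ k N Exz _ x z)) ⟩
      XX + bilinearForm k N (λ i l → Exz i l + Ezx l i) x z + ZZ
    ∎
    where
    Exx : Fin k → Fin k → Carrier
    Exx i j = E (i ↑ˡ N) (j ↑ˡ N)
    Exz : Fin k → Fin N → Carrier
    Exz i l = E (i ↑ˡ N) (k ↑ʳ l)
    Ezx : Fin N → Fin k → Carrier
    Ezx l j = E (k ↑ʳ l) (j ↑ˡ N)
    Ezz : Fin N → Fin N → Carrier
    Ezz l l′ = E (k ↑ʳ l) (k ↑ʳ l′)
    XX XZ ZX ZZ : Carrier
    XX = bilinearForm k k Exx x x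
    XZ = bilinearForm k N Exz x z
    ZX = bilinearForm N k Ezx z x
    ZZ = bilinearForm N N Ezz z z

  bilinearForm-units : ∀ {n} (i j : Fin n) E →
                       bilinearForm n n E (λ p → does (i ≟ p)) (λ q → does (j ≟ q)) ≡ E i j
  bilinearForm-units {n} i j E = begin
      ∑ n (λ p → ∑ n (λ q → E p q * (𝟙 (does (i ≟ p)) * 𝟙 (does (j ≟ q)))))
    ≡⟨ ∑²-cong (λ p q → rearrange (E p q) _ _) ⟩
      ∑ n (λ p → ∑ n (λ q → 𝟙 (does (j ≟ q)) * (𝟙 (does (i ≟ p)) * E p q)))
    ≡⟨ ∑-cong (λ p → ∑-δ j (λ q → 𝟙 (does (i ≟ p)) * E p q)) ⟩
      ∑ n (λ p → 𝟙 (does (i ≟ p)) * E p j)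
    ≡⟨ ∑-δ i (λ p → E p j) ⟩
      E i j
    ∎
    where
    rearrange : ∀ e x y → e * (x * y) ≡ y * (x * e)
    rearrange = solve 3 (λ e x y → e :* (x :* y) := y :* (x :* e)) refl

  upper : ∀ {n} → (Fin n → Fin n → Carrier) → Fin n → Fin n → Carrier
  upper e i j = if ⌊ i <? j ⌋ then e i j else 0#

  upper-nonpos : ∀ {n} {e : Fin n → Fin n → Carrier} → (∀ i j → i <ᶠ j → e i j ≤ 0#) → ∀ i j → upper e i j ≤ 0#
  upper-nonpos e≤0 i j with i <? j
  ... | yes i<j = e≤0 i j i<j
  ... | no  _   = ≤-refl

  Σ<≡bilinearForm-upper : ∀ n e (u v : Fin n → Bool) →
    Σ<[_] F n (λ i j → e i j * (𝟙 (u i) * 𝟙 (v j))) ≡ bilinearForm n n (upper e) u v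
  Σ<≡bilinearForm-upper n e u v = ∑²-cong (λ i j → sym (if-* ⌊ i <? j ⌋ (e i j) (𝟙 (u i) * 𝟙 (v j))))

  trichotomy-𝟙 : ∀ {n} (i j : Fin n) → 𝟙 ⌊ i <? j ⌋ + 𝟙 (does (i ≟ j)) + 𝟙 ⌊ j <? i ⌋ ≡ 1#
  trichotomy-𝟙 i j with <-cmp i j
  ... | tri< i<j i≢j j≮i rewrite ⌊⌋-true (i <? j) i<j | dec-false (i ≟ j) i≢j | ⌊⌋-false (j <? i) j≮i =
        trans (+-identityʳ _) (+-identityʳ 1#)
  ... | tri≈ i≮j i≡j j≮i rewrite ⌊⌋-false (i <? j) i≮j | dec-true (i ≟ j) i≡j | ⌊⌋-false (j <? i) j≮i =
        trans (+-identityʳ _) (+-identityˡ 1#)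
  ... | tri> i≮j i≢j j<i rewrite ⌊⌋-false (i <? j) i≮j | dec-false (i ≟ j) i≢j | ⌊⌋-true (j <? i) j<i =
        trans (cong (_+ 1#) (+-identityʳ 0#)) (+-identityˡ 1#)

  -- Split each term by the trichotomy i < j, i = j, j < i; the part j < i is transposed onto i < j.
  bilinearForm-symmetrise : ∀ n E (u : Fin n → Bool) →
    bilinearForm n n E u u
      ≡ linearForm n (λ i → E i i) u + Σ<[_] F n (λ i j → (E i j + E j i) * (𝟙 (u i) * 𝟙 (u j)))
  bilinearForm-symmetrise n E u = begin
      ∑ n (λ i → ∑ n (λ j → T i j))
    ≡⟨ ∑²-cong split ⟩
      ∑ n (λ i → ∑ n (λ j → 𝟙 ⌊ i <? j ⌋ * T i j + 𝟙 (does (i ≟ j)) * T i j + 𝟙 ⌊ j <? i ⌋ * T i j))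
    ≡⟨ trans (∑²-distrib-+ n n _ _) (cong (_+ below) (∑²-distrib-+ n n _ _)) ⟩
      above + ∑ n (λ i → ∑ n (λ j → 𝟙 (does (i ≟ j)) * T i j)) + below
    ≡⟨ cong₂ (λ D B → above + D + B) diagonal below≡ ⟩
      above + linearForm n (λ i → E i i) u + below′
    ≡⟨ solve 3 (λ A D B → A :+ D :+ B := D :+ (A :+ B)) refl above (linearForm n (λ i → E i i) u) below′ ⟩
      linearForm n (λ i → E i i) u + (above + below′)
    ≡⟨ cong (linearForm n (λ i → E i i) u +_) (trans (sym (∑²-distrib-+ n n _ _)) (∑²-cong merge)) ⟩
      linearForm n (λ i → E i i) u + Σ<[_] F n (λ i j → (E i j + E j i) * W i j)
    ∎
    where
    W T : Fin n → Fin n → Carrier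
    W i j = 𝟙 (u i) * 𝟙 (u j)
    T i j = E i j * W i j
    above below below′ : Carrier
    above  = ∑ n (λ i → ∑ n (λ j → 𝟙 ⌊ i <? j ⌋ * T i j))
    below  = ∑ n (λ i → ∑ n (λ j → 𝟙 ⌊ j <? i ⌋ * T i j))
    below′ = ∑ n (λ i → ∑ n (λ j → 𝟙 ⌊ i <? j ⌋ * (E j i * W i j)))
    split : ∀ i j → T i j ≡ 𝟙 ⌊ i <? j ⌋ * T i j + 𝟙 (does (i ≟ j)) * T i j + 𝟙 ⌊ j <? i ⌋ * T i j
    split i j = trans (sym (*-identityˡ (T i j)))
      (trans (cong (_* T i j) (sym (trichotomy-𝟙 i j)))
        (trans (distribʳ (T i j) _ _) (cong (_+ 𝟙 ⌊ j <? i ⌋ * T i j) (distribʳ (T i j) _ _))))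
    diagonal : ∑ n (λ i → ∑ n (λ j → 𝟙 (does (i ≟ j)) * T i j)) ≡ linearForm n (λ i → E i i) u
    diagonal = ∑-cong (λ i → trans (∑-δ i (T i)) (cong (E i i *_) (𝟙-idem (u i))))
    below≡ : below ≡ below′
    below≡ = trans (∑-comm n n _)
      (∑²-cong (λ i j → cong (λ w → 𝟙 ⌊ i <? j ⌋ * (E j i * w)) (*-comm (𝟙 (u j)) (𝟙 (u i)))))
    merge : ∀ i j → 𝟙 ⌊ i <? j ⌋ * T i j + 𝟙 ⌊ i <? j ⌋ * (E j i * W i j)
                   ≡ (if ⌊ i <? j ⌋ then (E i j + E j i) * W i j else 0#)
    merge i j = trans (sym (distribˡ _ _ _))
      (trans (cong (𝟙 ⌊ i <? j ⌋ *_) (sym (distribʳ (W i j) _ _))) (sym (if≡𝟙* ⌊ i <? j ⌋ _)))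

  -- Quadratic pseudo-Boolean polynomials

  QuadForm : ∀ n → Carrier → (Fin n → Carrier) → (Fin n → Fin n → Carrier) → (Fin n → Bool) → Carrier
  QuadForm n c d E u = c + linearForm n d u + bilinearForm n n E u u

  -- OrderLe2 f states f v ≡ Multilinear n d₀ d e (lookup v) for all v.
  Multilinear : ∀ n → Carrier → (Fin n → Carrier) → (Fin n → Fin n → Carrier) → (Fin n → Bool) → Carrier
  Multilinear n c d e u = c + linearForm n d u + Σ<[_] F n (λ i j → e i j * (𝟙 (u i) * 𝟙 (u j)))

  QuadForm-cong : ∀ n c d E {u u′ : Fin n → Bool} → (∀ i → u i ≡ u′ i) →
                  QuadForm n c d E u ≡ QuadForm n c d E u′
  QuadForm-cong n c d E u≗u′ =
    cong₂ (λ L B → c + L + B) (linearForm-cong n d u≗u′) (bilinearForm-cong n n E u≗u′ u≗u′)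

  QuadForm-push : ∀ {m n} (ρ : Fin m → Fin n) c d E (u : Fin n → Bool) →
                  QuadForm m c d E (u ∘ ρ) ≡ QuadForm n c (push ρ d) (push² ρ ρ E) u
  QuadForm-push ρ c d E u = cong₂ (λ L B → c + L + B) (linearForm-push ρ d u) (bilinearForm-push ρ ρ E u u)

  Multilinear≡QuadForm : ∀ n c d e u → Multilinear n c d e u ≡ QuadForm n c d (upper e) u
  Multilinear≡QuadForm n c d e u = cong (c + linearForm n d u +_) (Σ<≡bilinearForm-upper n e u u)

  QuadForm≡Multilinear : ∀ n c d E u →
    QuadForm n c d E u ≡ Multilinear n c (λ i → d i + E i i) (λ i j → E i j + E j i) u
  QuadForm≡Multilinear n c d E u = begin
      c + L + bilinearForm n n E u u
    ≡⟨ cong (c + L +_) (bilinearForm-symmetrise n E u) ⟩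
      c + L + (D + S)
    ≡⟨ solve 4 (λ c L D S → c :+ L :+ (D :+ S) := c :+ (L :+ D) :+ S) refl c L D S ⟩
      c + (L + D) + S
    ≡⟨ cong (λ l → c + l + S) (linearForm-+ n d (λ i → E i i) u) ⟩
      Multilinear n c (λ i → d i + E i i) (λ i j → E i j + E j i) u
    ∎
    where
    L D S : Carrier
    L = linearForm n d u
    D = linearForm n (λ i → E i i) u
    S = Σ<[_] F n (λ i j → (E i j + E j i) * (𝟙 (u i) * 𝟙 (u j)))

  QuadForm-modular : ∀ n c d E (X Y : Fin n → Bool) →
    QuadForm n c d E (λ i → X i ∨ Y i) + QuadForm n c d E (λ i → X i ∧ Y i)
      ≡ QuadForm n c d E X + QuadForm n c d E Y
        + ∑ n (λ p → ∑ n (λ q → E p q * crossing (X p) (X q) (Y p) (Y q)))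
  QuadForm-modular n c d E X Y = begin
      c + L X∨Y + Q X∨Y + (c + L X∧Y + Q X∧Y)
    ≡⟨ solve 5 (λ c l l′ q q′ → c :+ l :+ q :+ (c :+ l′ :+ q′) := c :+ c :+ (l :+ l′) :+ (q :+ q′))
               refl c (L X∨Y) (L X∧Y) (Q X∨Y) (Q X∧Y) ⟩
      c + c + (L X∨Y + L X∧Y) + (Q X∨Y + Q X∧Y)
    ≡⟨ cong₂ (λ l q → c + c + l + q) linear quadratic ⟩
      c + c + (L X + L Y) + (Q X + Q Y + K)
    ≡⟨ solve 6 (λ c l l′ q q′ k → c :+ c :+ (l :+ l′) :+ (q :+ q′ :+ k) := c :+ l :+ q :+ (c :+ l′ :+ q′) :+ k)
               refl c (L X) (L Y) (Q X) (Q Y) K ⟩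
      c + L X + Q X + (c + L Y + Q Y) + K
    ∎
    where
    X∨Y X∧Y : Fin n → Bool
    X∨Y i = X i ∨ Y i
    X∧Y i = X i ∧ Y i
    L Q : (Fin n → Bool) → Carrier
    L = linearForm n d
    Q u = bilinearForm n n E u u
    K : Carrier
    K = ∑ n (λ p → ∑ n (λ q → E p q * crossing (X p) (X q) (Y p) (Y q)))
    linear : L X∨Y + L X∧Y ≡ L X + L Y
    linear = trans (sym (∑-distrib-+ n _ _)) (trans (∑-cong (λ i →
      trans (sym (distribˡ (d i) _ _)) (trans (cong (d i *_) (𝟙-modular (X i) (Y i))) (distribˡ (d i) _ _))))
      (∑-distrib-+ n _ _))
    quadratic : Q X∨Y + Q X∧Y ≡ Q X + Q Y + K
    quadratic = trans (sym (∑²-distrib-+ n n _ _)) (trans (∑²-cong (λ p q →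
      trans (sym (distribˡ (E p q) _ _)) (trans (cong (E p q *_) (𝟙-modular² (X p) (X q) (Y p) (Y q)))
        (trans (distribˡ (E p q) _ _)
               (cong (_+ E p q * crossing (X p) (X q) (Y p) (Y q)) (distribˡ (E p q) _ _))))))
      (trans (∑²-distrib-+ n n _ _) (cong (_+ K) (∑²-distrib-+ n n _ _))))

  QuadForm-submodular : ∀ n c d E → (∀ i j → E i j ≤ 0#) → Submodular F (λ v → QuadForm n c d E (lookup v))
  QuadForm-submodular n c d E E≤0 X Y =
    subst (_≤ Q (lookup X) + Q (lookup Y)) (sym modular)
      (x+y≤x (∑-nonpos (λ p → ∑-nonpos (λ q →
        *crossing-nonpos (lookup X p) (lookup X q) (lookup Y p) (lookup Y q) (E≤0 p q)))))
    where
    Q : (Fin n → Bool) → Carrier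
    Q = QuadForm n c d E
    modular : Q (lookup (zipWith _∨_ X Y)) + Q (lookup (zipWith _∧_ X Y))
              ≡ Q (lookup X) + Q (lookup Y) + ∑ n (λ p → ∑ n (λ q →
                  E p q * crossing (lookup X p) (lookup X q) (lookup Y p) (lookup Y q)))
    modular = trans (cong₂ _+_ (QuadForm-cong n c d E (λ i → lookup-zipWith _∨_ i X Y))
                               (QuadForm-cong n c d E (λ i → lookup-zipWith _∧_ i X Y)))
                    (QuadForm-modular n c d E (lookup X) (lookup Y))

  ∑-crossing-units : ∀ {n} {i j : Fin n} → i ≢ j → (E : Fin n → Fin n → Carrier) →
    ∑ n (λ p → ∑ n (λ q → E p q * crossing (does (i ≟ p)) (does (i ≟ q)) (does (j ≟ p)) (does (j ≟ q))))
      ≡ E i j + E j i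
  ∑-crossing-units {n} {i} {j} i≢j E =
    trans (∑²-cong (λ p q → trans (cong (E p q *_) (crossing-units p q)) (distribˡ (E p q) _ _)))
      (trans (∑²-distrib-+ n n _ _)
        (cong₂ _+_ (bilinearForm-units i j E)
                   (trans (∑²-cong (λ p q → cong (E p q *_) (*-comm (𝟙 (x q)) (𝟙 (y p)))))
                          (bilinearForm-units j i E))))
    where
    x y : Fin n → Bool
    x p = does (i ≟ p)
    y p = does (j ≟ p)
    disjoint : ∀ p → x p ∧ y p ≡ false
    disjoint p with i ≟ p
    ... | yes refl = dec-false (j ≟ i) (i≢j ∘ sym)
    ... | no _     = refl
    crossing-units : ∀ p q → crossing (x p) (x q) (y p) (y q) ≡ 𝟙 (x p) * 𝟙 (y q) + 𝟙 (x q) * 𝟙 (y p)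
    crossing-units p q = cong₂ _+_
      (cong₂ (λ a b → 𝟙 a * 𝟙 b) (∧-not-disjoint (x p) (y p) (disjoint p))
                                 (not-∧-disjoint (x q) (y q) (disjoint q)))
      (trans (cong₂ (λ a b → 𝟙 a * 𝟙 b) (not-∧-disjoint (x p) (y p) (disjoint p))
                                        (∧-not-disjoint (x q) (y q) (disjoint q)))
             (*-comm (𝟙 (y p)) (𝟙 (x q))))

  Multilinear-submodular⇒nonpos : ∀ n c d e → Submodular F (λ v → Multilinear n c d e (lookup v)) →
                                  ∀ i j → i <ᶠ j → e i j ≤ 0#
  Multilinear-submodular⇒nonpos n c d e submodular i j i<j =
    +-cancelˡ-≤ (Q x + Q y) (subst₂ _≤_ join+meet units (submodular X Y))
    where
    x y : Fin n → Bool
    x p = does (i ≟ p)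
    y p = does (j ≟ p)
    X Y : Vec Bool n
    X = tabulate x
    Y = tabulate y
    M : Vec Bool n → Carrier
    M v = Multilinear n c d e (lookup v)
    Q : (Fin n → Bool) → Carrier
    Q = QuadForm n c d (upper e)
    at : ∀ v u → (∀ p → lookup v p ≡ u p) → M v ≡ Q u
    at v u v≗u = trans (Multilinear≡QuadForm n c d e (lookup v)) (QuadForm-cong n c d (upper e) v≗u)
    lookup-zipWith-units : ∀ (_⊕_ : Bool → Bool → Bool) p → lookup (zipWith _⊕_ X Y) p ≡ x p ⊕ y p
    lookup-zipWith-units _⊕_ p =
      trans (lookup-zipWith _⊕_ p X Y) (cong₂ _⊕_ (lookup∘tabulate x p) (lookup∘tabulate y p))
    i≢j : i ≢ j
    i≢j refl = <-irrefl refl i<j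
    upper-pair : upper e i j + upper e j i ≡ e i j
    upper-pair rewrite ⌊⌋-true (i <? j) i<j | ⌊⌋-false (j <? i) (<-asym i<j) = +-identityʳ (e i j)
    join+meet : M (zipWith _∨_ X Y) + M (zipWith _∧_ X Y) ≡ Q x + Q y + e i j
    join+meet = begin
        M (zipWith _∨_ X Y) + M (zipWith _∧_ X Y)
      ≡⟨ cong₂ _+_ (at (zipWith _∨_ X Y) _ (lookup-zipWith-units _∨_))
                   (at (zipWith _∧_ X Y) _ (lookup-zipWith-units _∧_)) ⟩
        Q (λ p → x p ∨ y p) + Q (λ p → x p ∧ y p)
      ≡⟨ QuadForm-modular n c d (upper e) x y ⟩
        Q x + Q y + ∑ n (λ p → ∑ n (λ q → upper e p q * crossing (x p) (x q) (y p) (y q)))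
      ≡⟨ cong (Q x + Q y +_) (trans (∑-crossing-units i≢j (upper e)) upper-pair) ⟩
        Q x + Q y + e i j
      ∎
    units : M X + M Y ≡ Q x + Q y + 0#
    units = trans (cong₂ _+_ (at X x (lookup∘tabulate x)) (at Y y (lookup∘tabulate y))) (sym (+-identityʳ _))

  -- Coefficient vectors as quadratic forms on 𝔹ᵏ⁺ᴺ

  push²-nonpos : ∀ {m m′ n n′} (ρ : Fin m → Fin n) (σ : Fin m′ → Fin n′) {E : Fin m → Fin m′ → Carrier} →
                 (∀ i j → E i j ≤ 0#) → ∀ p q → push² ρ σ E p q ≤ 0#
  push²-nonpos ρ σ E≤0 p q =
    ∑-nonpos (λ i → 𝟙*-nonpos (does (ρ i ≟ p)) (∑-nonpos (λ j → 𝟙*-nonpos (does (σ j ≟ q)) (E≤0 i j))))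

  module _ {k N : ℕ} where

    nonpositive : Coeffs F k N → Set
    nonpositive c = (∀ (i j : Fin k) → i <ᶠ j → α i j ≤ 0#)
                  × (∀ i l → β i l ≤ 0#)
                  × (∀ (l l′ : Fin N) → l <ᶠ l′ → γ l l′ ≤ 0#)
      where open Coeffs c

    linearPart : Coeffs F k N → Fin (k +ℕ N) → Carrier
    linearPart c p = push (_↑ˡ N) a p + push (k ↑ʳ_) b p
      where open Coeffs c

    quadraticPart : Coeffs F k N → Fin (k +ℕ N) → Fin (k +ℕ N) → Carrier
    quadraticPart c p q =
      push² (_↑ˡ N) (_↑ˡ N) (upper α) p q + push² (_↑ˡ N) (k ↑ʳ_) β p q + push² (k ↑ʳ_) (k ↑ʳ_) (upper γ) p q
      where open Coeffs c

    quadraticPart-nonpos : ∀ c → nonpositive c → ∀ p q → quadraticPart c p q ≤ 0#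
    quadraticPart-nonpos c (α≤0 , β≤0 , γ≤0) p q =
      +-nonpos (+-nonpos (push²-nonpos (_↑ˡ N) (_↑ˡ N) (upper-nonpos α≤0) p q)
                         (push²-nonpos (_↑ˡ N) (k ↑ʳ_) β≤0 p q))
               (push²-nonpos (k ↑ʳ_) (k ↑ʳ_) (upper-nonpos γ≤0) p q)

    H≡QuadForm : ∀ c x z →
      H F c x z ≡ QuadForm (k +ℕ N) (Coeffs.c₀ c) (linearPart c) (quadraticPart c) (lookup (x ++ z))
    H≡QuadForm c x z = begin
        H F c x z
      ≡⟨ cong₂ _+_ (cong₂ _+_ (cong₂ _+_ (cong₂ (λ s t → c₀ + s + t) lin-x lin-z) quad-xx) quad-xz) quad-zz ⟩
        c₀ + La + Lb + Bα + Bβ + Bγ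
      ≡⟨ solve 6 (λ c a b α β γ → c :+ a :+ b :+ α :+ β :+ γ := c :+ (a :+ b) :+ (α :+ β :+ γ))
                 refl c₀ La Lb Bα Bβ Bγ ⟩
        c₀ + (La + Lb) + (Bα + Bβ + Bγ)
      ≡⟨ cong₂ (λ L B → c₀ + L + B) (linearForm-+ _ _ _ u)
               (trans (cong (_+ Bγ) (bilinearForm-+ _ _ _ _ u u)) (bilinearForm-+ _ _ _ _ u u)) ⟩
        QuadForm (k +ℕ N) c₀ (linearPart c) (quadraticPart c) u
      ∎
      where
      open Coeffs c
      u : Fin (k +ℕ N) → Bool
      u = lookup (x ++ z)
      x≡ : ∀ i → lookup x i ≡ u (i ↑ˡ N)
      x≡ i = sym (lookup-++ˡ x z i)
      z≡ : ∀ l → lookup z l ≡ u (k ↑ʳ l)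
      z≡ l = sym (lookup-++ʳ x z l)
      La Lb Bα Bβ Bγ : Carrier
      La = linearForm (k +ℕ N) (push (_↑ˡ N) a) u
      Lb = linearForm (k +ℕ N) (push (k ↑ʳ_) b) u
      Bα = bilinearForm (k +ℕ N) (k +ℕ N) (push² (_↑ˡ N) (_↑ˡ N) (upper α)) u u
      Bβ = bilinearForm (k +ℕ N) (k +ℕ N) (push² (_↑ˡ N) (k ↑ʳ_) β) u u
      Bγ = bilinearForm (k +ℕ N) (k +ℕ N) (push² (k ↑ʳ_) (k ↑ʳ_) (upper γ)) u u
      lin-x : linearForm k a (lookup x) ≡ La
      lin-x = trans (linearForm-cong k a x≡) (linearForm-push (_↑ˡ N) a u)
      lin-z : linearForm N b (lookup z) ≡ Lb
      lin-z = trans (linearForm-cong N b z≡) (linearForm-push (k ↑ʳ_) b u)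
      quad-xx : Σ<[_] F k (λ i j → α i j * (𝟙 (lookup x i) * 𝟙 (lookup x j))) ≡ Bα
      quad-xx = trans (Σ<≡bilinearForm-upper k α (lookup x) (lookup x))
        (trans (bilinearForm-cong k k (upper α) x≡ x≡) (bilinearForm-push (_↑ˡ N) (_↑ˡ N) (upper α) u u))
      quad-xz : bilinearForm k N β (lookup x) (lookup z) ≡ Bβ
      quad-xz = trans (bilinearForm-cong k N β x≡ z≡) (bilinearForm-push (_↑ˡ N) (k ↑ʳ_) β u u)
      quad-zz : Σ<[_] F N (λ l l′ → γ l l′ * (𝟙 (lookup z l) * 𝟙 (lookup z l′))) ≡ Bγ
      quad-zz = trans (Σ<≡bilinearForm-upper N γ (lookup z) (lookup z))
        (trans (bilinearForm-cong N N (upper γ) z≡ z≡) (bilinearForm-push (k ↑ʳ_) (k ↑ʳ_) (upper γ) u u))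

    -- Diagonal entries of E act as linear coefficients (𝟙 b * 𝟙 b = 𝟙 b), and H has one coefficient
    -- per unordered pair of variables.
    blocks : Carrier → (Fin (k +ℕ N) → Carrier) → (Fin (k +ℕ N) → Fin (k +ℕ N) → Carrier) → Coeffs F k N
    blocks c d E = record
      { c₀ = c
      ; a  = λ i → d (i ↑ˡ N) + E (i ↑ˡ N) (i ↑ˡ N)
      ; b  = λ l → d (k ↑ʳ l) + E (k ↑ʳ l) (k ↑ʳ l)
      ; α  = λ i j → E (i ↑ˡ N) (j ↑ˡ N) + E (j ↑ˡ N) (i ↑ˡ N)
      ; β  = λ i l → E (i ↑ˡ N) (k ↑ʳ l) + E (k ↑ʳ l) (i ↑ˡ N)
      ; γ  = λ l l′ → E (k ↑ʳ l) (k ↑ʳ l′) + E (k ↑ʳ l′) (k ↑ʳ l)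
      }

    blocks-nonpos : ∀ c d E → (∀ p q → E p q ≤ 0#) → nonpositive (blocks c d E)
    blocks-nonpos c d E E≤0 =
        (λ i j _ → +-nonpos (E≤0 _ _) (E≤0 _ _))
      , (λ i l → +-nonpos (E≤0 _ _) (E≤0 _ _))
      , (λ l l′ _ → +-nonpos (E≤0 _ _) (E≤0 _ _))

    QuadForm≡H-blocks : ∀ c d E x z → QuadForm (k +ℕ N) c d E (lookup (x ++ z)) ≡ H F (blocks c d E) x z
    QuadForm≡H-blocks c d E x z = begin
        c + linearForm (k +ℕ N) d u + bilinearForm (k +ℕ N) (k +ℕ N) E u u
      ≡⟨ cong₂ (λ L B → c + L + B) (linearForm-++ k d u x≡ z≡) (bilinearForm-++ k E u x≡ z≡) ⟩
        c + (Lx + Lz) + (bilinearForm k k Exx X X + Mxz + bilinearForm N N Ezz Z Z)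
      ≡⟨ cong₂ (λ s t → c + (Lx + Lz) + (s + Mxz + t)) (bilinearForm-symmetrise k Exx X)
                                                        (bilinearForm-symmetrise N Ezz Z) ⟩
        c + (Lx + Lz) + (Dx + Sx + Mxz + (Dz + Sz))
      ≡⟨ solve 8 (λ c lx lz dx sx m dz sz → c :+ (lx :+ lz) :+ (dx :+ sx :+ m :+ (dz :+ sz))
                   := c :+ (lx :+ dx) :+ (lz :+ dz) :+ sx :+ m :+ sz)
                 refl c Lx Lz Dx Sx Mxz Dz Sz ⟩
        c + (Lx + Dx) + (Lz + Dz) + Sx + Mxz + Sz
      ≡⟨ cong₂ (λ s t → c + s + t + Sx + Mxz + Sz) (linearForm-+ k _ _ X) (linearForm-+ N _ _ Z) ⟩
        H F (blocks c d E) x z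
      ∎
      where
      u : Fin (k +ℕ N) → Bool
      u = lookup (x ++ z)
      X : Fin k → Bool
      X = lookup x
      Z : Fin N → Bool
      Z = lookup z
      x≡ : ∀ i → u (i ↑ˡ N) ≡ X i
      x≡ i = lookup-++ˡ x z i
      z≡ : ∀ l → u (k ↑ʳ l) ≡ Z l
      z≡ l = lookup-++ʳ x z l
      Exx : Fin k → Fin k → Carrier
      Exx i j = E (i ↑ˡ N) (j ↑ˡ N)
      Ezz : Fin N → Fin N → Carrier
      Ezz l l′ = E (k ↑ʳ l) (k ↑ʳ l′)
      Lx Lz Dx Dz Sx Sz Mxz : Carrier
      Lx  = linearForm k (d ∘ (_↑ˡ N)) X
      Lz  = linearForm N (d ∘ (k ↑ʳ_)) Z
      Dx  = linearForm k (λ i → Exx i i) X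
      Dz  = linearForm N (λ l → Ezz l l) Z
      Sx  = Σ<[_] F k (λ i j → (Exx i j + Exx j i) * (𝟙 (X i) * 𝟙 (X j)))
      Sz  = Σ<[_] F N (λ l l′ → (Ezz l l′ + Ezz l′ l) * (𝟙 (Z l) * 𝟙 (Z l′)))
      Mxz = bilinearForm k N (λ i l → E (i ↑ˡ N) (k ↑ʳ l) + E (k ↑ʳ l) (i ↑ˡ N)) X Z

  Submodular-resp : ∀ {n} {f g : PBF F n} → (∀ v → f v ≡ g v) → Submodular F f → Submodular F g
  Submodular-resp f≗g f-sub X Y =
    subst₂ _≤_ (cong₂ _+_ (f≗g _) (f≗g _)) (cong₂ _+_ (f≗g X) (f≗g Y)) (f-sub X Y)

  uncurry𝔹-++ : ∀ {k m} (h : Vec Bool k → Vec Bool m → Carrier) x w → uncurry𝔹 F h (x ++ w) ≡ h x w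
  uncurry𝔹-++ {k} h x w = cong₂ h (++-injectiveˡ _ x split) (++-injectiveʳ _ x split)
    where
    split : take k (x ++ w) ++ drop k (x ++ w) ≡ x ++ w
    split = take++drop≡id k (x ++ w)

  H-InF2 : ∀ {k N} (c : Coeffs F k N) → nonpositive c → InF2 F (uncurry𝔹 F (H F c))
  H-InF2 {k} {N} c c≤0 =
      Submodular-resp (sym ∘ H≡Q) (QuadForm-submodular _ c₀ (linearPart c) E (quadraticPart-nonpos c c≤0))
    , (c₀ , _ , _ , λ v → trans (H≡Q v) (QuadForm≡Multilinear _ c₀ (linearPart c) E (lookup v)))
    where
    open Coeffs c
    E : Fin (k +ℕ N) → Fin (k +ℕ N) → Carrier
    E = quadraticPart c
    H≡Q : ∀ v → uncurry𝔹 F (H F c) v ≡ QuadForm _ c₀ (linearPart c) E (lookup v)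
    H≡Q v = trans (H≡QuadForm c (take k v) (drop k v))
                  (cong (QuadForm _ c₀ (linearPart c) E ∘ lookup) (take++drop≡id k v))

  select : ∀ {M N} → (Fin M → Fin N) → Vec Bool N → Vec Bool M
  select π z = tabulate (λ j → lookup z (π j))

  H-represents-reindexing : ∀ {k M N} (h : Vec Bool k → Vec Bool M → Carrier) → InF2 F (uncurry𝔹 F h) →
    (π : Fin M → Fin N) → Σ (Coeffs F k N) λ c → nonpositive c × (∀ x z → H F c x z ≡ h x (select π z))
  H-represents-reindexing {k} {M} {N} h (h-sub , d₀ , d , e , h≡) π =
    blocks d₀ (push ρ d) E , blocks-nonpos d₀ (push ρ d) E E≤0 , λ x z → sym (begin
        h x (select π z)
      ≡⟨ sym (uncurry𝔹-++ h x (select π z)) ⟩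
        uncurry𝔹 F h (x ++ select π z)
      ≡⟨ trans (h≡ _) (Multilinear≡QuadForm _ d₀ d e (lookup (x ++ select π z))) ⟩
        QuadForm (k +ℕ M) d₀ d (upper e) (lookup (x ++ select π z))
      ≡⟨ QuadForm-cong _ d₀ d (upper e) (relabel x z) ⟩
        QuadForm (k +ℕ M) d₀ d (upper e) (lookup (x ++ z) ∘ ρ)
      ≡⟨ QuadForm-push ρ d₀ d (upper e) (lookup (x ++ z)) ⟩
        QuadForm (k +ℕ N) d₀ (push ρ d) E (lookup (x ++ z))
      ≡⟨ QuadForm≡H-blocks d₀ (push ρ d) E x z ⟩
        H F (blocks d₀ (push ρ d) E) x z
      ∎)
    where
    ρ : Fin (k +ℕ M) → Fin (k +ℕ N)
    ρ p = [ _↑ˡ N , (k ↑ʳ_) ∘ π ]′ (splitAt k p)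
    E : Fin (k +ℕ N) → Fin (k +ℕ N) → Carrier
    E = push² ρ ρ (upper e)
    E≤0 : ∀ p q → E p q ≤ 0#
    E≤0 = push²-nonpos ρ ρ (upper-nonpos (Multilinear-submodular⇒nonpos _ d₀ d e (Submodular-resp h≡ h-sub)))
    relabel : ∀ x z p → lookup (x ++ select π z) p ≡ lookup (x ++ z) (ρ p)
    relabel x z p = trans (lookup-splitAt k x (select π z) p) (on-blocks (splitAt k p))
      where
      on-blocks : ∀ s → [ lookup x , lookup (select π z) ]′ s ≡ lookup (x ++ z) ([ _↑ˡ N , (k ↑ʳ_) ∘ π ]′ s)
      on-blocks (inj₁ i) = sym (lookup-++ˡ x z i)
      on-blocks (inj₂ j) = trans (lookup∘tabulate _ j) (sym (lookup-++ʳ x z (π j)))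

  -- Monotone minimizers

  meet-minimizes : ∀ {k M} {h : Vec Bool k → Vec Bool M → Carrier} {f : PBF F k} →
                   Submodular F (uncurry𝔹 F h) → (∀ x → IsMinOver F (f x) (h x)) →
                   ∀ {x y w u} → x ⊆ y → h x w ≡ f x → h y u ≡ f y → h x (w ∩ u) ≡ f x
  meet-minimizes {h = h} {f} h-sub h-min {x} {y} {w} {u} x⊆y hw≡fx hu≡fy =
    ≤-antisym (+-cancelˡ-≤ (f y) (≤-trans (+-mono-≤ _ (proj₂ (h-min y) (w ∪ u))) submodular))
              (proj₂ (h-min x) (w ∩ u))
    where
    join : uncurry𝔹 F h ((x ++ w) ∪ (y ++ u)) ≡ h y (w ∪ u)
    join = trans (cong (uncurry𝔹 F h) (trans (zipWith-++ _∨_ x w y u) (cong (_++ w ∪ u) (p⊆q⇒p∪q≡q x⊆y))))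
                 (uncurry𝔹-++ h y (w ∪ u))
    meet : uncurry𝔹 F h ((x ++ w) ∩ (y ++ u)) ≡ h x (w ∩ u)
    meet = trans (cong (uncurry𝔹 F h) (trans (zipWith-++ _∧_ x w y u) (cong (_++ w ∩ u) (p⊆q⇒p∩q≡p x⊆y))))
                 (uncurry𝔹-++ h x (w ∩ u))
    submodular : h y (w ∪ u) + h x (w ∩ u) ≤ f y + f x
    submodular = subst₂ _≤_ (cong₂ _+_ join meet)
      (trans (cong₂ _+_ (trans (uncurry𝔹-++ h x w) hw≡fx) (trans (uncurry𝔹-++ h y u) hu≡fy))
             (+-comm (f x) (f y)))
      (h-sub (x ++ w) (y ++ u))

  monotone-minimizer : ∀ {k M} (h : Vec Bool k → Vec Bool M → Carrier) (f : PBF F k) →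
    Submodular F (uncurry𝔹 F h) → (∀ x → IsMinOver F (f x) (h x)) →
    Σ (Vec Bool k → Subset M) λ s → (∀ x → h x (s x) ≡ f x) × (∀ {x y} → x ⊆ y → s x ⊆ s y)
  monotone-minimizer {k} {M} h f h-sub h-min = s , s-minimizes , s-monotone
    where
    chosen : Vec Bool k → Subset M
    chosen x = proj₁ (proj₁ (h-min x))
    chosen-minimizes : ∀ x → h x (chosen x) ≡ f x
    chosen-minimizes x = proj₂ (proj₁ (h-min x))
    candidate : Vec Bool k → Subset k → Subset M
    candidate x y = if ⌊ x ⊆? y ⌋ then chosen x ∩ chosen y else chosen x
    s : Vec Bool k → Subset M
    s x = ⋂-cube (candidate x)
    s-minimizes : ∀ x → h x (s x) ≡ f x
    s-minimizes x =
      ⋂-cube-closed (λ w → h x w ≡ f x) (meet-minimizes h-sub h-min ⊆-refl) (candidate x) candidates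
      where
      candidates : ∀ y → h x (candidate x y) ≡ f x
      candidates y with x ⊆? y
      ... | yes x⊆y = meet-minimizes h-sub h-min x⊆y (chosen-minimizes x) (chosen-minimizes y)
      ... | no  _   = chosen-minimizes x
    s⊆chosen : ∀ {x y} → x ⊆ y → s x ⊆ chosen y
    s⊆chosen {x} {y} x⊆y = ⊆-trans (⋂-cube-lower (candidate x) y) candidate⊆chosen
      where
      candidate⊆chosen : candidate x y ⊆ chosen y
      candidate⊆chosen with x ⊆? y
      ... | yes _   = p∩q⊆q _ _
      ... | no x⊈y = contradiction (λ {i} → x⊆y {i}) x⊈y
    s-monotone : ∀ {x y} → x ⊆ y → s x ⊆ s y
    s-monotone {x} {y} x⊆y = ⋂-cube-greatest (candidate y) below
      where
      below : ∀ v → s x ⊆ candidate y v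
      below v with y ⊆? v
      ... | yes y⊆v = λ i∈sx → x∈p∩q⁺ (s⊆chosen x⊆y i∈sx , s⊆chosen (⊆-trans x⊆y y⊆v) i∈sx)
      ... | no  _   = s⊆chosen x⊆y

  monotone-selection-enumerated : ∀ {k M N} {m : Fin N → Vec Bool k → Bool} → EnumeratesMonotone F N m →
    (s : Vec Bool k → Subset M) → (∀ {x y} → x ⊆ y → s x ⊆ s y) →
    Σ (Fin M → Fin N) λ π → ∀ x → select π (mvec F m x) ≡ s x
  monotone-selection-enumerated {k} {M} {N} {m} (_ , enumerated , _) s s-monotone =
    π , λ x → trans (tabulate-cong (λ j → trans (lookup∘tabulate (λ l → m l x) (π j)) (π-enumerates j x)))
                    (tabulate∘lookup (s x))
    where
    coordinate-monotone : ∀ j → Monotonic F (λ x → lookup (s x) j)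
    coordinate-monotone j x y y≤x = ⊆⇒lookup-≤ (s-monotone (lookup-≤⇒⊆ y≤x)) j
    π : Fin M → Fin N
    π j = proj₁ (enumerated _ (coordinate-monotone j))
    π-enumerates : ∀ j x → m (π j) x ≡ lookup (s x) j
    π-enumerates j = proj₂ (enumerated _ (coordinate-monotone j))

  -- The linear program

  ∑𝔹 : (n : ℕ) → (Vec Bool n → Carrier) → Carrier
  ∑𝔹 = Σ𝔹[_] F

  ∑𝔹-zero : ∀ n → ∑𝔹 n (λ _ → 0#) ≡ 0#
  ∑𝔹-zero zero    = refl
  ∑𝔹-zero (suc n) = trans (cong₂ _+_ (∑𝔹-zero n) (∑𝔹-zero n)) (+-identityʳ 0#)

  ∑𝔹-nonneg : ∀ n {t : Vec Bool n → Carrier} → (∀ x → 0# ≤ t x) → 0# ≤ ∑𝔹 n t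
  ∑𝔹-nonneg zero    t≥0 = t≥0 []
  ∑𝔹-nonneg (suc n) t≥0 = +-nonneg (∑𝔹-nonneg n (t≥0 ∘ (false ∷_))) (∑𝔹-nonneg n (t≥0 ∘ (true ∷_)))

  ∑𝔹-nonneg-≤0 : ∀ n {t : Vec Bool n → Carrier} → (∀ x → 0# ≤ t x) → ∑𝔹 n t ≤ 0# → ∀ x → t x ≡ 0#
  ∑𝔹-nonneg-≤0 zero    t≥0 ∑≤0 [] = ≤-antisym ∑≤0 (t≥0 [])
  ∑𝔹-nonneg-≤0 (suc n) t≥0 ∑≤0 (false ∷ x) =
    ∑𝔹-nonneg-≤0 n (t≥0 ∘ (false ∷_)) (≤-trans (x≤x+y (∑𝔹-nonneg n (t≥0 ∘ (true ∷_)))) ∑≤0) x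
  ∑𝔹-nonneg-≤0 (suc n) t≥0 ∑≤0 (true ∷ x) =
    ∑𝔹-nonneg-≤0 n (t≥0 ∘ (true ∷_))
      (≤-trans (x≤x+y (∑𝔹-nonneg n (t≥0 ∘ (false ∷_)))) (subst (_≤ 0#) (+-comm _ _) ∑≤0)) x

  module _ {k N} (m : Fin N → Vec Bool k → Bool) (f : PBF F k) where
    open LP F m f

    feasible-nonneg : ∀ {c t} → Feasible c t → ∀ x → 0# ≤ t x
    feasible-nonneg (fit , _) x = distance-nonneg (proj₁ (fit x)) (proj₂ (fit x))

    feasible-nonpositive : ∀ {c t} → Feasible c t → nonpositive c
    feasible-nonpositive (_ , α≤0 , β≤0 , γ≤0 , _) = α≤0 , β≤0 , γ≤0

    exact-feasible : ∀ {c} → nonpositive c → (∀ x → H F c x (mvec F m x) ≡ f x) →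
                     (∀ x z → f x ≤ H F c x z) → Feasible c (λ _ → 0#)
    exact-feasible {c} (α≤0 , β≤0 , γ≤0) exact lower =
        (λ x → ≤-reflexive (trans (cong (λ v → f x + - v) (exact x)) (-‿inverseʳ (f x)))
             , ≤-reflexive (trans (cong (_+ - f x) (exact x)) (-‿inverseʳ (f x))))
      , α≤0 , β≤0 , γ≤0
      , λ x z → subst (_≤ H F c x z) (sym (exact x)) (lower x z)

    zero-optimal : ∀ {c} → Feasible c (λ _ → 0#) → Optimal c (λ _ → 0#)
    zero-optimal feasible =
      feasible , λ _ t′ feasible′ →
        subst (_≤ objective t′) (sym (∑𝔹-zero k)) (∑𝔹-nonneg k (feasible-nonneg feasible′))

    optimal-minimizes : ∀ {c t c′} → Optimal c t → Feasible c′ (λ _ → 0#) → ∀ x → IsMinOver F (f x) (H F c x)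
    optimal-minimizes {c} {t} (feasible@(fit , _ , _ , _ , minimal) , optimal) feasible′ x =
      (mvec F m x , exact) , λ z → subst (_≤ H F c x z) exact (minimal x z)
      where
      t≡0 : t x ≡ 0#
      t≡0 = ∑𝔹-nonneg-≤0 k (feasible-nonneg feasible)
                           (subst (objective t ≤_) (∑𝔹-zero k) (optimal _ _ feasible′)) x
      exact : H F c x (mvec F m x) ≡ f x
      exact = ≤-antisym (x-y≤0⇒x≤y (subst (_ ≤_) t≡0 (proj₂ (fit x))))
                        (x-y≤0⇒x≤y (subst (_ ≤_) t≡0 (proj₁ (fit x))))

theorem1 : (F : OrderedField) → let open OrderedField F in
    (k : ℕ) → k ≥ 1 →
    (N : ℕ) (m : Fin N → Vec Bool k → Bool) → EnumeratesMonotone F N m →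
    (f : PBF F k) → InFk2 F f →
    let open LP F m f in
    (Σ (Coeffs F k N) λ c → Σ (Vec Bool k → Carrier) λ t → Optimal c t × objective t ≡ 0#)
    × (∀ c t → Optimal c t →
    InF2 F (uncurry𝔹 F (H F c)) × (∀ x → IsMinOver F (f x) (H F c x)))
theorem1 F k _ N m enumerates f (_ , M , h , h∈𝓕² , h-minimizes) =
  let open OrderedField F
      s , s-minimizes , s-monotone = monotone-minimizer F h f (proj₁ h∈𝓕²) h-minimizes
      π , π-selects-s = monotone-selection-enumerated F enumerates s s-monotone
      c , c≤0 , H≡h = H-represents-reindexing F h h∈𝓕² π
      exact : ∀ x → H F c x (mvec F m x) ≡ f x
      exact x = trans (H≡h x (mvec F m x)) (trans (cong (h x) (π-selects-s x)) (s-minimizes x))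
      lower : ∀ x z → f x ≤ H F c x z
      lower x z = subst (f x ≤_) (sym (H≡h x z)) (proj₂ (h-minimizes x) (select F π z))
      feasible : LP.Feasible F m f c (λ _ → 0#)
      feasible = exact-feasible F m f c≤0 exact lower
  in (c , (λ _ → 0#) , zero-optimal F m f feasible , ∑𝔹-zero F k)
   , λ c′ t′ optimal → H-InF2 F c′ (feasible-nonpositive F m f (proj₁ optimal))
                      , optimal-minimizes F m f optimal feasible
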